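{- Let $\mathcal{X}$ be a family of nonempty subsets of $[d]$ and let $M$ be an $\mathcal{X}$-matroid on $[d]$. Then $\mathrm{rank}_M(F)\leq v_{\mathcal{X}}(F)$ for every $F\subseteq[d]$.
   Context: An $\mathcal{X}$-matroid is a matroid on $[d]$ in which every set of $\mathcal{X}$ is a circuit. A proper $\mathcal{X}$-sequence is a (possibly empty) sequence $\mathcal{S}=(X_1,\dots,X_k)$ of sets in $\mathcal{X}$ with $X_i\not\subseteq\bigcup_{j<i}X_j$ for $i=2,\dots,k$; $\mathrm{val}(F,\mathcal{S})=|F\cup\bigcup_{i}X_i|-k$ and $\mathrm{val}_{\mathcal{X}}(F)=\min_{\mathcal{S}}\mathrm{val}(F,\mathcal{S})$. Starting from $h_1=\mathrm{val}_{\mathcal{X}}$, functions $h_n:2^{[d]}\to\mathbb{Z}$ are updated by: (i) if there exist $A,B\subseteq[d]$, $x\in\mathcal{X}$ with $A\cap B\subseteq x$ and $h_n(A\cup B)>h_n(A)+h_n(B)-\min\{|A\cap B|,|x|-1\}$, set $h_{n+1}(A\cup B)$ equal to the right-hand side (other values unchanged); (ii) otherwise, if some $A\subsetneq B$ has $h_n(A)>h_n(B)$, set $h_{n+1}(A)=h_n(B)$; (iii) otherwise, if some $B\subsetneq A$ has $h_n(A)>h_n(B)+|A\setminus B|$, set $h_{n+1}(A)=h_n(B)+|A\setminus B|$; (iv) otherwise $h_{n+1}=h_n$. The sequence eventually stabilizes, and its final value, which does not depend on the choices made, is $v_{\mathcal{X}}$. -}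

module Defs where

open import Data.Nat as ℕ using (ℕ; _∸_)
open import Data.Integer as ℤ using (ℤ; +_; _+_; _-_; _<_)
open import Data.Fin using (Fin)
open import Data.Fin.Subset
  using (Subset; ⊥; ⁅_⁆; _∈_; _∉_; _⊆_; _⊈_; _⊂_; _∩_; _∪_; _─_; ⋃; ∣_∣; Nonempty)
open import Data.List using (List; []; _∷_; length)
open import Data.List.Relation.Unary.All using (All)
open import Data.List.Membership.Propositional using () renaming (_∈_ to _∈ₗ_)
open import Data.Product using (Σ; ∃; ∃-syntax; _×_; _,_)
open import Data.Sum using (_⊎_)
open import Data.Unit using (⊤)
open import Relation.Nullary using (¬_)
open import Relation.Binary.PropositionalEquality using (_≡_; _≢_)
open import Relation.Binary.Construct.Closure.ReflexiveTransitive using (Star)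

record Matroid (d : ℕ) : Set₁ where
  field
    Indep      : Subset d → Set
    indep-∅    : Indep ⊥
    indep-↓    : ∀ {I J} → J ⊆ I → Indep I → Indep J
    indep-aug  : ∀ {I J} → Indep I → Indep J → ∣ I ∣ ℕ.< ∣ J ∣ →
                 ∃[ e ] (e ∈ J × e ∉ I × Indep (I ∪ ⁅ e ⁆))

module _ {d : ℕ} (M : Matroid d) where
  open Matroid M

  IsRank : Subset d → ℕ → Set
  IsRank F r =
    (∃[ I ] (I ⊆ F × Indep I × ∣ I ∣ ≡ r)) ×
    (∀ I → I ⊆ F → Indep I → ∣ I ∣ ℕ.≤ r)

  IsCircuit : Subset d → Set
  IsCircuit C = ¬ Indep C × (∀ D → D ⊂ C → Indep D)

IsXMatroid : ∀ {d} → List (Subset d) → Matroid d → Set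
IsXMatroid 𝒳 M = All (IsCircuit M) 𝒳

module _ {d : ℕ} (𝒳 : List (Subset d)) where

  -- remaining part of a sequence, given the union U of the earlier sets
  ProperFrom : Subset d → List (Subset d) → Set
  ProperFrom U []      = ⊤
  ProperFrom U (Y ∷ S) = Y ∈ₗ 𝒳 × Y ⊈ U × ProperFrom (U ∪ Y) S

  ProperSeq : List (Subset d) → Set
  ProperSeq []      = ⊤
  ProperSeq (Y ∷ S) = Y ∈ₗ 𝒳 × ProperFrom Y S

  val : Subset d → List (Subset d) → ℤ
  val F S = (+ ∣ F ∪ ⋃ S ∣) - (+ length S)

  IsValX : (Subset d → ℤ) → Set
  IsValX h = ∀ F →
    (∃[ S ] (ProperSeq S × val F S ≡ h F)) ×
    (∀ S → ProperSeq S → h F ℤ.≤ val F S)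

  UpdateAt : (Subset d → ℤ) → Subset d → ℤ → (Subset d → ℤ) → Set
  UpdateAt h C z h' = h' C ≡ z × (∀ D → D ≢ C → h' D ≡ h D)

  rhsI : (Subset d → ℤ) → Subset d → Subset d → Subset d → ℤ
  rhsI h A B x = (h A + h B) - (+ (∣ A ∩ B ∣ ℕ.⊓ (∣ x ∣ ∸ 1)))

  RuleI : (Subset d → ℤ) → Subset d → Subset d → Subset d → Set
  RuleI h A B x = x ∈ₗ 𝒳 × A ∩ B ⊆ x × rhsI h A B x < h (A ∪ B)

  RuleII : (Subset d → ℤ) → Subset d → Subset d → Set
  RuleII h A B = A ⊂ B × h B < h A

  RuleIII : (Subset d → ℤ) → Subset d → Subset d → Set
  RuleIII h A B = B ⊂ A × h B + (+ ∣ A ─ B ∣) < h A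

  NoI NoII NoIII : (Subset d → ℤ) → Set
  NoI   h = ∀ A B x → ¬ RuleI h A B x
  NoII  h = ∀ A B → ¬ RuleII h A B
  NoIII h = ∀ A B → ¬ RuleIII h A B

  -- one (non-trivial) step h_n ↦ h_{n+1}, respecting the priority (i) > (ii) > (iii)
  Step : (Subset d → ℤ) → (Subset d → ℤ) → Set
  Step h h' =
    (∃[ A ] ∃[ B ] ∃[ x ] (RuleI h A B x × UpdateAt h (A ∪ B) (rhsI h A B x) h'))
    ⊎ (NoI h × ∃[ A ] ∃[ B ] (RuleII h A B × UpdateAt h A (h B) h'))
    ⊎ (NoI h × NoII h × ∃[ A ] ∃[ B ]
         (RuleIII h A B × UpdateAt h A (h B + (+ ∣ A ─ B ∣)) h'))

  IsVX : (Subset d → ℤ) → Set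
  IsVX v = ∃[ h₁ ] (IsValX h₁ × Star Step h₁ v) × NoI v × NoII v × NoIII v

{-# OPTIONS --safe #-}
-- Every function reached by the update procedure bounds the rank from above, starting with val_𝒳:
-- adding a circuit X ⊈ U to U raises the rank by at most |X ─ U| − 1, so along a proper sequence
-- S = (X₁, …, X_k) the rank of ⋃ S is at most |⋃ S| − k, and adding F costs at most |F ─ ⋃ S|.
-- Rule (i) preserves the bound by submodularity, r(A ∪ B) + r(A ∩ B) ≤ r(A) + r(B), because a
-- subset A ∩ B of the circuit x has rank at least min(|A ∩ B|, |x| − 1); rules (ii) and (iii)
-- preserve it because r is monotone and r(A) ≤ r(B) + |A ─ B|.
module Submission where

open import Defs
open import Data.Nat using (ℕ)
open import Data.Integer using (ℤ; +_; _≤_)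
open import Data.Fin.Subset using (Subset; Nonempty)
open import Data.List using (List)
open import Data.List.Relation.Unary.All using (All)

open import Algebra.Properties.CommutativeSemigroup using (xy∙z≈xz∙y)
open import Data.Bool using () renaming (_≟_ to _≟ᵇ_)
import Data.Fin as Fin
open import Data.Fin.Properties using (¬∀⟶∃¬)
open import Data.Fin.Subset
  using (⁅_⁆; _∈_; _∉_; _⊆_; _⊈_; _⊂_; _∩_; _∪_; _─_; _-_; ⋃; ∣_∣; inside; outside)
open import Data.Fin.Subset.Properties
  using ( _∈?_; _⊆?_; ⊆-refl; ⊆-trans; p⊆q⇒∣p∣≤∣q∣; p⊂q⇒∣p∣<∣q∣; x∈⁅x⁆; x∈⁅y⁆⇒x≡y
        ; p⊆p∪q; q⊆p∪q; x∈p∪q⁻; ∪-assoc; ∪-identityʳ; p∩q⊆p; p∩q⊆q; x∈p∩q⁺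
        ; x∈p∧x∉q⇒x∈p─q; p─q⊆p; x∈p⇒p-x⊂p; ∣p∩q∣≤∣q∣; ∣⁅x⁆∣≡1 )
import Data.Integer as ℤ
import Data.Integer.Properties as ℤₚ
open import Algebra.Properties.AbelianGroup ℤₚ.+-0-abelianGroup using (//-rightDividesʳ)
open import Data.List using ([]; _∷_; length)
import Data.List.Relation.Unary.All as All
open import Data.Nat as ℕ using (zero; suc; _+_; _∸_; _⊓_; s≤s)
import Data.Nat.Properties as ℕₚ
open import Data.Product using (∃-syntax; _×_; _,_; proj₁; proj₂)
open import Data.Sum using (inj₁; inj₂; [_,_])
open import Data.Vec using ([]; _∷_; here; there)
open import Data.Vec.Properties using (≡-dec)
open import Function using (_∘_; id)
open import Relation.Binary.Construct.Closure.ReflexiveTransitive using (Star; ε; _◅_)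
open import Relation.Binary.PropositionalEquality using (_≡_; refl; sym; trans; cong; subst)
open import Relation.Nullary using (yes; no; contradiction)
open import Relation.Nullary.Decidable using (_→-dec_)

x∈p─q⁻ : ∀ {n} (p q : Subset n) {x} → x ∈ p ─ q → x ∈ p × x ∉ q
x∈p─q⁻ (inside  ∷ p) (outside ∷ q) here = here , λ ()
x∈p─q⁻ (outside ∷ p) (outside ∷ q) {Fin.zero} ()
x∈p─q⁻ (_       ∷ p) (inside  ∷ q) {Fin.zero} ()
x∈p─q⁻ (_ ∷ p) (_ ∷ q) (there x∈p─q) with x∈p─q⁻ p q x∈p─q
... | x∈p , x∉q = there x∈p , λ { (there x∈q) → x∉q x∈q }

p⊈q⇒∃x∈p∧x∉q : ∀ {n} {p q : Subset n} → p ⊈ q → ∃[ x ] (x ∈ p × x ∉ q)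
p⊈q⇒∃x∈p∧x∉q {n} {p} {q} p⊈q
  with ¬∀⟶∃¬ n (λ x → x ∈ p → x ∈ q) (λ x → x ∈? p →-dec x ∈? q) (λ p⊆q → p⊈q (p⊆q _))
... | x , x∈p↛x∈q with x ∈? p
...   | yes x∈p = x , x∈p , λ x∈q → x∈p↛x∈q (λ _ → x∈q)
...   | no  x∉p = contradiction (λ x∈p → contradiction x∈p x∉p) x∈p↛x∈q

⊆∧⊈⇒⊂ : ∀ {n} {p q : Subset n} → p ⊆ q → q ⊈ p → p ⊂ q
⊆∧⊈⇒⊂ p⊆q q⊈p = p⊆q , p⊈q⇒∃x∈p∧x∉q q⊈p

∪-⊆ : ∀ {n} {p q r : Subset n} → p ⊆ r → q ⊆ r → p ∪ q ⊆ r
∪-⊆ {p = p} {q} p⊆r q⊆r x∈p∪q = [ p⊆r , q⊆r ] (x∈p∪q⁻ p q x∈p∪q)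

x∈p⇒⁅x⁆⊆p : ∀ {n} {p : Subset n} {x} → x ∈ p → ⁅ x ⁆ ⊆ p
x∈p⇒⁅x⁆⊆p {x = x} x∈p y∈⁅x⁆ = subst (_∈ _) (sym (x∈⁅y⁆⇒x≡y x y∈⁅x⁆)) x∈p

p⊆q∪r⇒p─q⊆r : ∀ {n} {p q r : Subset n} → p ⊆ q ∪ r → p ─ q ⊆ r
p⊆q∪r⇒p─q⊆r {p = p} {q} {r} p⊆q∪r x∈p─q with x∈p─q⁻ p q x∈p─q
... | x∈p , x∉q = [ (λ x∈q → contradiction x∈q x∉q) , id ] (x∈p∪q⁻ q r (p⊆q∪r x∈p))

∣p∣≡∣p∩q∣+∣p─q∣ : ∀ {n} (p q : Subset n) → ∣ p ∣ ≡ ∣ p ∩ q ∣ + ∣ p ─ q ∣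
∣p∣≡∣p∩q∣+∣p─q∣ []            []            = refl
∣p∣≡∣p∩q∣+∣p─q∣ (inside  ∷ p) (inside  ∷ q) = cong suc (∣p∣≡∣p∩q∣+∣p─q∣ p q)
∣p∣≡∣p∩q∣+∣p─q∣ (inside  ∷ p) (outside ∷ q) =
  trans (cong suc (∣p∣≡∣p∩q∣+∣p─q∣ p q)) (sym (ℕₚ.+-suc _ _))
∣p∣≡∣p∩q∣+∣p─q∣ (outside ∷ p) (inside  ∷ q) = ∣p∣≡∣p∩q∣+∣p─q∣ p q
∣p∣≡∣p∩q∣+∣p─q∣ (outside ∷ p) (outside ∷ q) = ∣p∣≡∣p∩q∣+∣p─q∣ p q

∣p∪q∣≡∣p∣+∣q─p∣ : ∀ {n} (p q : Subset n) → ∣ p ∪ q ∣ ≡ ∣ p ∣ + ∣ q ─ p ∣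
∣p∪q∣≡∣p∣+∣q─p∣ []            []            = refl
∣p∪q∣≡∣p∣+∣q─p∣ (inside  ∷ p) (inside  ∷ q) = cong suc (∣p∪q∣≡∣p∣+∣q─p∣ p q)
∣p∪q∣≡∣p∣+∣q─p∣ (inside  ∷ p) (outside ∷ q) = cong suc (∣p∪q∣≡∣p∣+∣q─p∣ p q)
∣p∪q∣≡∣p∣+∣q─p∣ (outside ∷ p) (inside  ∷ q) =
  trans (cong suc (∣p∪q∣≡∣p∣+∣q─p∣ p q)) (sym (ℕₚ.+-suc _ _))
∣p∪q∣≡∣p∣+∣q─p∣ (outside ∷ p) (outside ∷ q) = ∣p∪q∣≡∣p∣+∣q─p∣ p q

∣p∣≤1+∣p-x∣ : ∀ {n} (p : Subset n) x → ∣ p ∣ ℕ.≤ 1 + ∣ p - x ∣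
∣p∣≤1+∣p-x∣ p x = begin
  ∣ p ∣                      ≡⟨ ∣p∣≡∣p∩q∣+∣p─q∣ p ⁅ x ⁆ ⟩
  ∣ p ∩ ⁅ x ⁆ ∣ + ∣ p - x ∣  ≤⟨ ℕₚ.+-monoˡ-≤ _ (∣p∩q∣≤∣q∣ p ⁅ x ⁆) ⟩
  ∣ ⁅ x ⁆ ∣ + ∣ p - x ∣      ≡⟨ cong (_+ ∣ p - x ∣) (∣⁅x⁆∣≡1 x) ⟩
  1 + ∣ p - x ∣              ∎
  where open ℕₚ.≤-Reasoning

disjoint-⊆⇒∣p∣+∣q∣≤∣r∣ : ∀ {n} {p q r : Subset n} → p ⊆ r → q ⊆ r →
                         (∀ {x} → x ∈ q → x ∉ p) → ∣ p ∣ + ∣ q ∣ ℕ.≤ ∣ r ∣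
disjoint-⊆⇒∣p∣+∣q∣≤∣r∣ {p = p} {q} {r} p⊆r q⊆r q∩p≡∅ = begin
  ∣ p ∣ + ∣ q ∣      ≤⟨ ℕₚ.+-monoʳ-≤ ∣ p ∣ (p⊆q⇒∣p∣≤∣q∣ q⊆q─p) ⟩
  ∣ p ∣ + ∣ q ─ p ∣  ≡⟨ ∣p∪q∣≡∣p∣+∣q─p∣ p q ⟨
  ∣ p ∪ q ∣          ≤⟨ p⊆q⇒∣p∣≤∣q∣ (∪-⊆ p⊆r q⊆r) ⟩
  ∣ r ∣              ∎
  where
  open ℕₚ.≤-Reasoning
  q⊆q─p : q ⊆ q ─ p
  q⊆q─p x∈q = x∈p∧x∉q⇒x∈p─q x∈q (q∩p≡∅ x∈q)

∣p─r∣+∣q─r∪p∣≤∣p∪q─r∣ : ∀ {n} (p q r : Subset n) →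
                        ∣ p ─ r ∣ + ∣ q ─ (r ∪ p) ∣ ℕ.≤ ∣ (p ∪ q) ─ r ∣
∣p─r∣+∣q─r∪p∣≤∣p∪q─r∣ p q r = disjoint-⊆⇒∣p∣+∣q∣≤∣r∣ p─r⊆ q─r∪p⊆ disjoint
  where
  p─r⊆ : p ─ r ⊆ (p ∪ q) ─ r
  p─r⊆ x∈p─r with x∈p─q⁻ p r x∈p─r
  ... | x∈p , x∉r = x∈p∧x∉q⇒x∈p─q (p⊆p∪q q x∈p) x∉r
  q─r∪p⊆ : q ─ (r ∪ p) ⊆ (p ∪ q) ─ r
  q─r∪p⊆ x∈q─r∪p with x∈p─q⁻ q (r ∪ p) x∈q─r∪p
  ... | x∈q , x∉r∪p = x∈p∧x∉q⇒x∈p─q (q⊆p∪q p q x∈q) (x∉r∪p ∘ p⊆p∪q p)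
  disjoint : ∀ {x} → x ∈ q ─ (r ∪ p) → x ∉ p ─ r
  disjoint x∈q─r∪p x∈p─r =
    proj₂ (x∈p─q⁻ q (r ∪ p) x∈q─r∪p) (q⊆p∪q r p (proj₁ (x∈p─q⁻ p r x∈p─r)))

i+j≤k⇒i≤k-j : ∀ {i j k} → i ℤ.+ j ≤ k → i ≤ k ℤ.- j
i+j≤k⇒i≤k-j {i} {j} {k} i+j≤k = begin
  i              ≡⟨ //-rightDividesʳ j i ⟨
  i ℤ.+ j ℤ.- j  ≤⟨ ℤₚ.+-monoˡ-≤ (ℤ.- j) i+j≤k ⟩
  k ℤ.- j        ∎
  where open ℤₚ.≤-Reasoning

module MatroidRank {d : ℕ} (M : Matroid d) where
  open Matroid M

  augment : ∀ {C I J} → J ⊆ C → I ⊆ C → Indep J → Indep I →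
            ∃[ K ] (J ⊆ K × K ⊆ C × Indep K × ∣ I ∣ ℕ.≤ ∣ K ∣)
  augment {C} {I} J⊆C I⊆C iJ iI = go ∣ I ∣ J⊆C iJ (ℕₚ.m≤m+n ∣ I ∣ _)
    where
    go : ∀ fuel {J} → J ⊆ C → Indep J → ∣ I ∣ ℕ.≤ fuel + ∣ J ∣ →
         ∃[ K ] (J ⊆ K × K ⊆ C × Indep K × ∣ I ∣ ℕ.≤ ∣ K ∣)
    go fuel {J} J⊆C iJ I≤ with ∣ I ∣ ℕₚ.≤? ∣ J ∣
    ... | yes I≤J = J , ⊆-refl , J⊆C , iJ , I≤J
    go zero       J⊆C iJ I≤ | no I≰J = contradiction I≤ I≰J
    go (suc fuel) {J} J⊆C iJ I≤ | no I≰J with indep-aug iJ iI (ℕₚ.≰⇒> I≰J)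
    ... | e , e∈I , e∉J , iJ+e
      with go fuel (∪-⊆ J⊆C (x∈p⇒⁅x⁆⊆p (I⊆C e∈I))) iJ+e (ℕₚ.≤-trans I≤ fuel+∣J∣<)
      where
      fuel+∣J∣< : suc fuel + ∣ J ∣ ℕ.≤ fuel + ∣ J ∪ ⁅ e ⁆ ∣
      fuel+∣J∣< = ℕₚ.≤-trans (ℕₚ.≤-reflexive (sym (ℕₚ.+-suc fuel ∣ J ∣)))
        (ℕₚ.+-monoʳ-≤ fuel (p⊂q⇒∣p∣<∣q∣ (p⊆p∪q _ , e , q⊆p∪q J _ (x∈⁅x⁆ e) , e∉J)))
    ... | K , J+e⊆K , K⊆C , iK , I≤K = K , J+e⊆K ∘ p⊆p∪q _ , K⊆C , iK , I≤K

  circuit⊈indep : ∀ {Y K} → IsCircuit M Y → Indep K → Y ⊈ K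
  circuit⊈indep (dependent , _) iK Y⊆K = dependent (indep-↓ Y⊆K iK)

  -- r(W ∪ Y) ≤ r(W) + |Y ─ W| − 1, with an independent J ⊆ W standing in for r(W).
  rank-∪-circuit : ∀ {Y W I} → IsCircuit M Y → Y ⊈ W → I ⊆ W ∪ Y → Indep I →
                 ∃[ J ] (J ⊆ W × Indep J × suc ∣ I ∣ ℕ.≤ ∣ J ∣ + ∣ Y ─ W ∣)
  rank-∪-circuit {Y} {W} {I} circuit@(_ , minimal) Y⊈W I⊆W∪Y iI
    with augment (q⊆p∪q W Y ∘ p∩q⊆p Y W) I⊆W∪Y iY∩W iI
    where
    iY∩W : Indep (Y ∩ W)
    iY∩W = minimal (Y ∩ W) (⊆∧⊈⇒⊂ (p∩q⊆p Y W) (λ Y⊆Y∩W → Y⊈W (⊆-trans Y⊆Y∩W (p∩q⊆q Y W))))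
  ... | K , Y∩W⊆K , K⊆W∪Y , iK , ∣I∣≤∣K∣ =
    K ∩ W , p∩q⊆q K W , indep-↓ (p∩q⊆p K W) iK , bound
    where
    K─W⊂Y─W : K ─ W ⊂ Y ─ W
    K─W⊂Y─W with p⊈q⇒∃x∈p∧x∉q (circuit⊈indep circuit iK)
    ... | y , y∈Y , y∉K =
      (λ x∈K─W → x∈p∧x∉q⇒x∈p─q (p⊆q∪r⇒p─q⊆r K⊆W∪Y x∈K─W) (proj₂ (x∈p─q⁻ K W x∈K─W))) ,
      y , x∈p∧x∉q⇒x∈p─q y∈Y (λ y∈W → y∉K (Y∩W⊆K (x∈p∩q⁺ (y∈Y , y∈W)))) ,
      y∉K ∘ proj₁ ∘ x∈p─q⁻ K W
    open ℕₚ.≤-Reasoning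
    bound : suc ∣ I ∣ ℕ.≤ ∣ K ∩ W ∣ + ∣ Y ─ W ∣
    bound = begin
      suc ∣ I ∣                     ≤⟨ s≤s ∣I∣≤∣K∣ ⟩
      suc ∣ K ∣                     ≡⟨ cong suc (∣p∣≡∣p∩q∣+∣p─q∣ K W) ⟩
      suc (∣ K ∩ W ∣ + ∣ K ─ W ∣)   ≡⟨ ℕₚ.+-suc _ _ ⟨
      ∣ K ∩ W ∣ + (suc ∣ K ─ W ∣)   ≤⟨ ℕₚ.+-monoʳ-≤ ∣ K ∩ W ∣ (p⊂q⇒∣p∣<∣q∣ K─W⊂Y─W) ⟩
      ∣ K ∩ W ∣ + ∣ Y ─ W ∣         ∎

  submodular : ∀ {A B I J} → I ⊆ A ∪ B → Indep I → J ⊆ A ∩ B → Indep J →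
               ∃[ K ] (Indep K × ∣ I ∣ + ∣ J ∣ ℕ.≤ ∣ K ∩ A ∣ + ∣ K ∩ B ∣)
  submodular {A} {B} {I} {J} I⊆A∪B iI J⊆A∩B iJ
    with augment (p⊆p∪q B ∘ p∩q⊆p A B ∘ J⊆A∩B) I⊆A∪B iJ iI
  ... | K , J⊆K , K⊆A∪B , iK , ∣I∣≤∣K∣ = K , iK , (begin
      ∣ I ∣ + ∣ J ∣                        ≤⟨ ℕₚ.+-monoˡ-≤ ∣ J ∣ ∣I∣≤∣K∣ ⟩
      ∣ K ∣ + ∣ J ∣                        ≡⟨ cong (_+ ∣ J ∣) (∣p∣≡∣p∩q∣+∣p─q∣ K A) ⟩
      ∣ K ∩ A ∣ + ∣ K ─ A ∣ + ∣ J ∣        ≡⟨ ℕₚ.+-assoc ∣ K ∩ A ∣ _ _ ⟩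
      ∣ K ∩ A ∣ + (∣ K ─ A ∣ + ∣ J ∣)      ≤⟨ ℕₚ.+-monoʳ-≤ ∣ K ∩ A ∣ ∣K─A∣+∣J∣≤∣K∩B∣ ⟩
      ∣ K ∩ A ∣ + ∣ K ∩ B ∣                ∎)
    where
    open ℕₚ.≤-Reasoning
    K─A⊆K∩B : K ─ A ⊆ K ∩ B
    K─A⊆K∩B x∈K─A = x∈p∩q⁺ (proj₁ (x∈p─q⁻ K A x∈K─A) , p⊆q∪r⇒p─q⊆r K⊆A∪B x∈K─A)
    J⊆K∩B : J ⊆ K ∩ B
    J⊆K∩B x∈J = x∈p∩q⁺ (J⊆K x∈J , p∩q⊆q A B (J⊆A∩B x∈J))
    J∩[K─A]≡∅ : ∀ {x} → x ∈ J → x ∉ K ─ A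
    J∩[K─A]≡∅ x∈J x∈K─A = proj₂ (x∈p─q⁻ K A x∈K─A) (p∩q⊆p A B (J⊆A∩B x∈J))
    ∣K─A∣+∣J∣≤∣K∩B∣ : ∣ K ─ A ∣ + ∣ J ∣ ℕ.≤ ∣ K ∩ B ∣
    ∣K─A∣+∣J∣≤∣K∩B∣ = disjoint-⊆⇒∣p∣+∣q∣≤∣r∣ K─A⊆K∩B J⊆K∩B J∩[K─A]≡∅

  circuit-subset-rank : ∀ {X C} → IsCircuit M X → Nonempty X → C ⊆ X →
                          ∃[ J ] (J ⊆ C × Indep J × ∣ C ∣ ⊓ (∣ X ∣ ∸ 1) ℕ.≤ ∣ J ∣)
  circuit-subset-rank {X} {C} (_ , minimal) _ C⊆X with X ⊆? C
  ... | no X⊈C = C , ⊆-refl , minimal C (⊆∧⊈⇒⊂ C⊆X X⊈C) , ℕₚ.m⊓n≤m _ _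
  circuit-subset-rank {X} {C} (_ , minimal) (e , e∈X) C⊆X | yes X⊆C =
    X - e , ⊆-trans (p─q⊆p X ⁅ e ⁆) X⊆C , minimal (X - e) (x∈p⇒p-x⊂p e∈X) ,
    ℕₚ.≤-trans (ℕₚ.m⊓n≤n _ _) (ℕₚ.m≤n+o⇒m∸n≤o ∣ X ∣ 1 (∣p∣≤1+∣p-x∣ X e))

  RankAtMost : Subset d → ℤ → Set
  RankAtMost F z = ∀ {I} → I ⊆ F → Indep I → + ∣ I ∣ ≤ z

  rankAtMost-∩ : ∀ {B z I} → RankAtMost B z → Indep I → + ∣ I ∩ B ∣ ≤ z
  rankAtMost-∩ {B} {I = I} rank≤z iI = rank≤z (p∩q⊆q I B) (indep-↓ (p∩q⊆p I B) iI)

  rankAtMost-⊆ : ∀ {A B z} → A ⊆ B → RankAtMost B z → RankAtMost A z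
  rankAtMost-⊆ A⊆B rank≤z I⊆A = rank≤z (⊆-trans I⊆A A⊆B)

  rankAtMost-─ : ∀ {A B z} → RankAtMost B z → RankAtMost A (z ℤ.+ + ∣ A ─ B ∣)
  rankAtMost-─ {A} {B} {z} rank≤z {I} I⊆A iI = begin
    + ∣ I ∣                         ≡⟨ cong +_ (∣p∣≡∣p∩q∣+∣p─q∣ I B) ⟩
    + (∣ I ∩ B ∣ + ∣ I ─ B ∣)       ≡⟨ ℤₚ.pos-+ ∣ I ∩ B ∣ _ ⟩
    + ∣ I ∩ B ∣ ℤ.+ + ∣ I ─ B ∣     ≤⟨ ℤₚ.+-mono-≤ (rankAtMost-∩ rank≤z iI)
                                                    (ℤ.+≤+ (p⊆q⇒∣p∣≤∣q∣ I─B⊆A─B)) ⟩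
    z ℤ.+ + ∣ A ─ B ∣               ∎
    where
    open ℤₚ.≤-Reasoning
    I─B⊆A─B : I ─ B ⊆ A ─ B
    I─B⊆A─B x∈I─B with x∈p─q⁻ I B x∈I─B
    ... | x∈I , x∉B = x∈p∧x∉q⇒x∈p─q (I⊆A x∈I) x∉B

  rankAtMost-∪ : ∀ {A B a b J m} → RankAtMost A a → RankAtMost B b →
                 J ⊆ A ∩ B → Indep J → m ℕ.≤ ∣ J ∣ →
                 RankAtMost (A ∪ B) (a ℤ.+ b ℤ.- + m)
  rankAtMost-∪ {A} {B} {a} {b} {J} {m} rankA≤a rankB≤b J⊆A∩B iJ m≤∣J∣ {I} I⊆A∪B iI
    with submodular I⊆A∪B iI J⊆A∩B iJ
  ... | K , iK , ∣I∣+∣J∣≤ = i+j≤k⇒i≤k-j (begin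
    + ∣ I ∣ ℤ.+ + m                 ≡⟨ ℤₚ.pos-+ ∣ I ∣ m ⟨
    + (∣ I ∣ + m)                   ≤⟨ ℤ.+≤+ (ℕₚ.≤-trans (ℕₚ.+-monoʳ-≤ ∣ I ∣ m≤∣J∣) ∣I∣+∣J∣≤) ⟩
    + (∣ K ∩ A ∣ + ∣ K ∩ B ∣)       ≡⟨ ℤₚ.pos-+ ∣ K ∩ A ∣ _ ⟩
    + ∣ K ∩ A ∣ ℤ.+ + ∣ K ∩ B ∣     ≤⟨ ℤₚ.+-mono-≤ (rankAtMost-∩ rankA≤a iK)
                                                    (rankAtMost-∩ rankB≤b iK) ⟩
    a ℤ.+ b                         ∎)
    where open ℤₚ.≤-Reasoning

module XMatroid {d : ℕ} {𝒳 : List (Subset d)} (M : Matroid d)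
                (𝒳-circuits : IsXMatroid 𝒳 M) (𝒳-nonempty : All Nonempty 𝒳) where
  open Matroid M
  open MatroidRank M

  -- r(U ∪ ⋃ S) + k ≤ r(U) + |⋃ S ─ U|, in the same form.
  properFrom-rank : ∀ {U} S → ProperFrom 𝒳 U S → ∀ {I} → I ⊆ U ∪ ⋃ S → Indep I →
                    ∃[ J ] (J ⊆ U × Indep J × ∣ I ∣ + length S ℕ.≤ ∣ J ∣ + ∣ ⋃ S ─ U ∣)
  properFrom-rank {U} [] _ {I} I⊆U∪∅ iI =
    I , subst (I ⊆_) (∪-identityʳ U) I⊆U∪∅ , iI , ℕₚ.+-monoʳ-≤ ∣ I ∣ ℕ.z≤n
  properFrom-rank {U} (Y ∷ S) (Y∈𝒳 , Y⊈U , proper) {I} I⊆ iI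
    with properFrom-rank S proper (subst (I ⊆_) (sym (∪-assoc U Y (⋃ S))) I⊆) iI
  ... | J′ , J′⊆U∪Y , iJ′ , ∣I∣+k≤
    with rank-∪-circuit (All.lookup 𝒳-circuits Y∈𝒳) Y⊈U J′⊆U∪Y iJ′
  ... | J , J⊆U , iJ , ∣J′∣<  = J , J⊆U , iJ , (begin
    ∣ I ∣ + suc (length S)                     ≡⟨ ℕₚ.+-suc ∣ I ∣ _ ⟩
    suc (∣ I ∣ + length S)                     ≤⟨ s≤s ∣I∣+k≤ ⟩
    (suc ∣ J′ ∣) + ∣ ⋃ S ─ (U ∪ Y) ∣           ≤⟨ ℕₚ.+-monoˡ-≤ _ ∣J′∣< ⟩
    ∣ J ∣ + ∣ Y ─ U ∣ + ∣ ⋃ S ─ (U ∪ Y) ∣      ≡⟨ ℕₚ.+-assoc ∣ J ∣ _ _ ⟩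
    ∣ J ∣ + (∣ Y ─ U ∣ + ∣ ⋃ S ─ (U ∪ Y) ∣)    ≤⟨ ℕₚ.+-monoʳ-≤ ∣ J ∣
                                                      (∣p─r∣+∣q─r∪p∣≤∣p∪q─r∣ Y (⋃ S) U) ⟩
    ∣ J ∣ + ∣ (Y ∪ ⋃ S) ─ U ∣                  ∎)
    where open ℕₚ.≤-Reasoning

  properSeq-rank : ∀ S → ProperSeq 𝒳 S → ∀ {I} → I ⊆ ⋃ S → Indep I →
                   ∣ I ∣ + length S ℕ.≤ ∣ ⋃ S ∣
  properSeq-rank [] _ {I} I⊆∅ _ =
    ℕₚ.≤-trans (ℕₚ.≤-reflexive (ℕₚ.+-identityʳ ∣ I ∣)) (p⊆q⇒∣p∣≤∣q∣ I⊆∅)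
  properSeq-rank (X ∷ S) (X∈𝒳 , proper) {I} I⊆ iI with properFrom-rank S proper I⊆ iI
  ... | J , J⊆X , iJ , ∣I∣+k≤ = begin
    ∣ I ∣ + suc (length S)       ≡⟨ ℕₚ.+-suc ∣ I ∣ _ ⟩
    suc (∣ I ∣ + length S)       ≤⟨ s≤s ∣I∣+k≤ ⟩
    (suc ∣ J ∣) + ∣ ⋃ S ─ X ∣    ≤⟨ ℕₚ.+-monoˡ-≤ _ (p⊂q⇒∣p∣<∣q∣ J⊂X) ⟩
    ∣ X ∣ + ∣ ⋃ S ─ X ∣          ≡⟨ ∣p∪q∣≡∣p∣+∣q─p∣ X (⋃ S) ⟨
    ∣ X ∪ ⋃ S ∣                  ∎
    where
    open ℕₚ.≤-Reasoning
    J⊂X : J ⊂ X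
    J⊂X = ⊆∧⊈⇒⊂ J⊆X (circuit⊈indep (All.lookup 𝒳-circuits X∈𝒳) iJ)

  val-rankAtMost : ∀ {S} F → ProperSeq 𝒳 S → RankAtMost F (val 𝒳 F S)
  val-rankAtMost {S} F proper {I} I⊆F iI = i+j≤k⇒i≤k-j {j = + length S} (begin
    + ∣ I ∣ ℤ.+ + length S          ≡⟨ ℤₚ.pos-+ ∣ I ∣ _ ⟨
    + (∣ I ∣ + length S)            ≤⟨ ℤ.+≤+ ∣I∣+k≤∣F∪W∣ ⟩
    + ∣ F ∪ W ∣                     ∎)
    where
    W = ⋃ S
    ∣I∣+k≤∣F∪W∣ : ∣ I ∣ + length S ℕ.≤ ∣ F ∪ W ∣
    ∣I∣+k≤∣F∪W∣ = begin
      ∣ I ∣ + length S                       ≡⟨ cong (_+ length S) (∣p∣≡∣p∩q∣+∣p─q∣ I W) ⟩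
      ∣ I ∩ W ∣ + ∣ I ─ W ∣ + length S       ≡⟨ xy∙z≈xz∙y ℕₚ.+-commutativeSemigroup ∣ I ∩ W ∣ _ _ ⟩
      ∣ I ∩ W ∣ + length S + ∣ I ─ W ∣       ≤⟨ ℕₚ.+-monoˡ-≤ _ ∣I∩W∣+k≤∣W∣ ⟩
      ∣ W ∣ + ∣ I ─ W ∣                      ≤⟨ disjoint-⊆⇒∣p∣+∣q∣≤∣r∣ (q⊆p∪q F W) I─W⊆F∪W
                                                   (proj₂ ∘ x∈p─q⁻ I W) ⟩
      ∣ F ∪ W ∣                              ∎
      where
      open ℕₚ.≤-Reasoning
      ∣I∩W∣+k≤∣W∣ : ∣ I ∩ W ∣ + length S ℕ.≤ ∣ W ∣
      ∣I∩W∣+k≤∣W∣ = properSeq-rank S proper (p∩q⊆q I W) (indep-↓ (p∩q⊆p I W) iI)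
      I─W⊆F∪W : I ─ W ⊆ F ∪ W
      I─W⊆F∪W = p⊆p∪q W ∘ I⊆F ∘ proj₁ ∘ x∈p─q⁻ I W
    open ℤₚ.≤-Reasoning

  BoundsRank : (Subset d → ℤ) → Set
  BoundsRank h = ∀ F → RankAtMost F (h F)

  valX-boundsRank : ∀ {h} → IsValX 𝒳 h → BoundsRank h
  valX-boundsRank isValX F with isValX F
  ... | (S , proper , val≡h) , _ = subst (RankAtMost F) val≡h (val-rankAtMost F proper)

  updateAt-boundsRank : ∀ {h C z h′} → UpdateAt 𝒳 h C z h′ →
                        BoundsRank h → RankAtMost C z → BoundsRank h′
  updateAt-boundsRank {C = C} (h′C≡z , h′D≡hD) bounds rankC≤z D with ≡-dec _≟ᵇ_ D C
  ... | yes refl = subst (RankAtMost C) (sym h′C≡z) rankC≤z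
  ... | no D≢C  = subst (RankAtMost D) (sym (h′D≡hD D D≢C)) (bounds D)

  step-boundsRank : ∀ {h h′} → Step 𝒳 h h′ → BoundsRank h → BoundsRank h′
  step-boundsRank (inj₁ (A , B , x , (x∈𝒳 , A∩B⊆x , _) , update)) bounds
    with circuit-subset-rank (All.lookup 𝒳-circuits x∈𝒳) (All.lookup 𝒳-nonempty x∈𝒳) A∩B⊆x
  ... | J , J⊆A∩B , iJ , m≤∣J∣ =
    updateAt-boundsRank update bounds (rankAtMost-∪ (bounds A) (bounds B) J⊆A∩B iJ m≤∣J∣)
  step-boundsRank (inj₂ (inj₁ (_ , A , B , ((A⊆B , _) , _) , update))) bounds =
    updateAt-boundsRank update bounds (rankAtMost-⊆ A⊆B (bounds B))
  step-boundsRank (inj₂ (inj₂ (_ , _ , A , B , _ , update))) bounds =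
    updateAt-boundsRank update bounds (rankAtMost-─ (bounds B))

  steps-boundsRank : ∀ {h h′} → Star (Step 𝒳) h h′ → BoundsRank h → BoundsRank h′
  steps-boundsRank ε              bounds = bounds
  steps-boundsRank (step ◅ steps) bounds = steps-boundsRank steps (step-boundsRank step bounds)

lemma6p9 : (d : ℕ) (𝒳 : List (Subset d)) → All Nonempty 𝒳 →
           (M : Matroid d) → IsXMatroid 𝒳 M →
           (v : Subset d → ℤ) → IsVX 𝒳 v →
           (F : Subset d) (r : ℕ) → IsRank M F r → + r ≤ v F
lemma6p9 d 𝒳 𝒳-nonempty M 𝒳-circuits v (_ , (isValX , steps) , _) F r
         ((I , I⊆F , iI , ∣I∣≡r) , _) =
  subst (λ n → + n ≤ v F) ∣I∣≡r (steps-boundsRank steps (valX-boundsRank isValX) F I⊆F iI)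
  where open XMatroid M 𝒳-circuits 𝒳-nonempty
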